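{- For every $D\in\mathbb{R}_{>0}$ there is $C\in\mathbb{R}_{>0}$ such that the following holds. Let $q$ be a positive integer, let $A\subset\mathbb{Z}/q\mathbb{Z}$ with $\gcd(A\cup\{q\})=1$, and let $\alpha,\beta\in\mathbb{Z}/q\mathbb{Z}$ be such that $\beta A\subset A\cup \alpha A$ and $|\alpha|\le D$. Let $\rho\in(0,C^{ -1})$, $r\in\mathbb{Z}_{>0}$, $u_1,\ldots,u_r\in\mathbb{Z}/q\mathbb{Z}$ and $l_1,\ldots,l_r\in\mathbb{Z}_{>0}$ be such that \begin{enumerate} \item $u_{i}\in B(A,D^{ -1}\rho)$ for all $i$; \item $B(A,\rho)\subset\left\{ \sum_{i=1}^{r}n_{i}u_{i}:n_i\in\mathbb{Z},\ |n_{i}|\le l_{i}\right\} \subset B(A,D\rho)$; \item if $n_i\in\mathbb{Z}$ with $|n_{i}|\le D^{ -1}l_{i}/\rho$ for all $i$ and $\sum_{i=1}^{r}n_{i}u_{i}\in B(A,t\rho)$ for some $1\le t\le{\rho}^{ -1}/2$, then $|n_{i}|\le Dtl_{i}$ for all $i$. \end{enumerate} Then there is a matrix $B=(B_{i,j})\in M_r(\mathbb{Z})$ such that \[ \beta\,(u_1,\ldots, u_r)^{T}\equiv B\,(u_1,\ldots,u_r)^{T} \mod q \] and $|B_{i,j}|\le C l_j/l_i$ for all $i,j$.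
   Context: For $a\in\mathbb{Z}/q\mathbb{Z}$, $|a|:=\min\{|a'|:a'\in\mathbb{Z},\ a'\in a+q\mathbb{Z}\}$. For $A\subset\mathbb{Z}/q\mathbb{Z}$ and $\rho\ge 0$, $B(A,\rho)=\{x\in\mathbb{Z}/q\mathbb{Z}: |xa|\le\rho q\text{ for all } a\in A\}$. The condition $\gcd(A\cup\{q\})=1$ means that $q$ and integer representatives of all elements of $A$ have greatest common divisor $1$. $\beta A=\{\beta a:a\in A\}$, $\alpha A=\{\alpha a: a\in A\}$.
   Formalization: The parameters D and ρ range over the positive rationals instead of the positive reals, and the constants C and t are taken in ℚ. -}

module Defs where

open import Data.Nat as ℕ using (ℕ; NonZero)
open import Data.Nat.Divisibility as ND using ()
open import Data.Integer as ℤ using (ℤ; +_; ∣_∣; _%ℕ_)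
open import Data.Integer.Divisibility using () renaming (_∣_ to _∣ℤ_)
open import Data.Rational as ℚ using (ℚ; Positive; 1/_)
open import Data.Rational.Properties using (pos⇒nonZero)
open import Data.Fin using (Fin; zero; suc)
open import Data.List using (List)
open import Data.List.Membership.Propositional using (_∈_)
open import Data.Product using (∃; _×_)
open import Data.Sum using (_⊎_)
open import Relation.Binary.PropositionalEquality renaming (_≡_ to _≡ₚ_)

-- Elements of ℤ/qℤ are represented by integers; equality in ℤ/qℤ is
-- congruence modulo q.
infix 4 _≡_[mod_]
_≡_[mod_] : ℤ → ℤ → ℕ → Set
x ≡ y [mod q ] = (+ q) ∣ℤ (x ℤ.- y)

ℕtoℚ : ℕ → ℚ
ℕtoℚ n = + n ℚ./ 1

-- |a| for a ∈ ℤ/qℤ : distance of a representative to the nearest multiple of q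
∣_∣[_] : ℤ → (q : ℕ) → .{{NonZero q}} → ℕ
∣ a ∣[ q ] = ℕ._⊓_ (a %ℕ q) (q ℕ.∸ (a %ℕ q))

recip : (p : ℚ) → .{{Positive p}} → ℚ
recip p = (1/ p) {{pos⇒nonZero p}}

-- x ∈ B(A, ρ) : |x a| ≤ ρ q for all a ∈ A
InB : (q : ℕ) → .{{NonZero q}} → List ℤ → ℚ → ℤ → Set
InB q A ρ x = ∀ a → a ∈ A → ℕtoℚ (∣ x ℤ.* a ∣[ q ]) ℚ.≤ ρ ℚ.* ℕtoℚ q

GcdOne : ℕ → List ℤ → Set
GcdOne q A = ∀ (d : ℕ) → d ND.∣ q → (∀ a → a ∈ A → d ND.∣ ∣ a ∣) → d ≡ₚ 1

MulSub : ℕ → List ℤ → ℤ → ℤ → Set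
MulSub q A α β = ∀ a → a ∈ A → ∃ λ b → (b ∈ A) × ((β ℤ.* a ≡ b [mod q ]) ⊎ (β ℤ.* a ≡ α ℤ.* b [mod q ]))

sumFin : (r : ℕ) → (Fin r → ℤ) → ℤ
sumFin ℕ.zero f = + 0
sumFin (ℕ.suc r) f = f zero ℤ.+ sumFin r (λ i → f (suc i))

lin : (r : ℕ) → (Fin r → ℤ) → (Fin r → ℤ) → ℤ
lin r n u = sumFin r (λ i → n i ℤ.* u i)

-- Since every βa (a ∈ A) is congruent to some b or αb with b ∈ A, multiplication
-- by β maps B(A, σ) ∩ α⁻¹B(A, σ) into B(A, σ), and |α| ≤ D gives
-- αB(A, σ) ⊆ B(A, Dσ).  Hypotheses 1 and 2 put u_i in B(A, min(D, D⁻¹) ρ) ⊆ B(A, ρ)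
-- and αu_i in B(A, ρ), so βu_i ∈ B(A, ρ) and hypothesis 2 writes
-- βu_i = Σ_j B_ij u_j with |B_ij| ≤ l_j.
-- To sharpen this bound, let m ≤ l_i.  Then m u_i ∈ B(A, Dρ) by hypothesis 2,
-- so m βu_i = Σ_j m B_ij u_j lies in B(A, tρ) with t = max(1, D, D²).
-- If |(m - 1) B_ij| ≤ K l_j for all j (K = Dt), then |m B_ij| ≤ (K + 1) l_j,
-- which is within the range of hypothesis 3, and it returns |m B_ij| ≤ K l_j.
-- Induction up to m = l_i gives |B_ij| ≤ K l_j / l_i.

{-# OPTIONS --safe #-}
module Submission where

open import Defs
open import Data.Nat as ℕ using (ℕ; NonZero; zero; suc)
import Data.Nat.Properties as ℕ
open import Data.Integer as ℤ using (ℤ; +_; -[1+_]; ∣_∣; _%ℕ_; _/ℕ_)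
import Data.Integer.Properties as ℤ
open import Data.Integer.DivMod using (a≡a%ℕn+[a/ℕn]*n; n%ℕd<d)
open import Data.Integer.Divisibility.Signed as Signed
  using (divides; ∣ᵤ⇒∣; ∣⇒∣ᵤ; ∣m⇒∣-m; ∣m∣n⇒∣m+n; ∣n⇒∣m*n)
open import Data.Integer.Tactic.RingSolver using (solve-∀)
open import Data.Rational as ℚ using (ℚ; Positive; _≤_; _<_; _*_; _+_; _⊔_; ½; 0ℚ; 1ℚ)
import Data.Rational.Properties as ℚ
import Data.Rational.Unnormalised as ℚᵘ
import Data.Rational.Unnormalised.Properties as ℚᵘ
open import Data.Rational.Solver using (module +-*-Solver)
open +-*-Solver using (solve; _:=_; _:+_; _:*_; con)
open import Data.Fin using (Fin; zero; suc)
open import Data.List using (List)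
open import Data.List.Membership.Propositional using (_∈_)
open import Data.Product using (Σ; ∃; _×_; _,_; proj₁; proj₂)
open import Data.Sum using (_⊎_; inj₁; inj₂)
open import Relation.Binary.PropositionalEquality
open import Relation.Nullary using (yes; no)

-- Defs' congruence unfolds to a divisibility of ∣ x ℤ.- y ∣, from which Agda
-- cannot infer x and y; wrapping it in a record makes them inferable.
infix 4 _≋_[mod_]
record _≋_[mod_] (x y : ℤ) (q : ℕ) : Set where
  constructor ≋-mod
  field ≡-mod : x ≡ y [mod q ]

module _ {q : ℕ} where

  ≋⇒∣ : ∀ {x y} → x ≋ y [mod q ] → + q Signed.∣ x ℤ.- y
  ≋⇒∣ {x} {y} (≋-mod x≡y) = ∣ᵤ⇒∣ {+ q} {x ℤ.- y} x≡y

  ∣⇒≋ : ∀ {x y} → + q Signed.∣ x ℤ.- y → x ≋ y [mod q ]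
  ∣⇒≋ q∣x-y = ≋-mod (∣⇒∣ᵤ q∣x-y)

  ≋-sym : ∀ {x y} → x ≋ y [mod q ] → y ≋ x [mod q ]
  ≋-sym {x} {y} x≋y = ∣⇒≋ (subst (+ q Signed.∣_) (neg-minus x y) (∣m⇒∣-m (≋⇒∣ x≋y)))
    where
    neg-minus : ∀ x y → ℤ.- (x ℤ.- y) ≡ y ℤ.- x
    neg-minus = solve-∀

  ≋-trans : ∀ {x y z} → x ≋ y [mod q ] → y ≋ z [mod q ] → x ≋ z [mod q ]
  ≋-trans {x} {y} {z} x≋y y≋z =
    ∣⇒≋ (subst (+ q Signed.∣_) (ℤ.+-minus-telescope x y z) (∣m∣n⇒∣m+n (≋⇒∣ x≋y) (≋⇒∣ y≋z)))

  ≋-*ˡ : ∀ c {x y} → x ≋ y [mod q ] → c ℤ.* x ≋ c ℤ.* y [mod q ]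
  ≋-*ˡ c {x} {y} x≋y =
    ∣⇒≋ (subst (+ q Signed.∣_) (*-distribˡ-minus c x y) (∣n⇒∣m*n c (≋⇒∣ x≋y)))
    where
    *-distribˡ-minus : ∀ c x y → c ℤ.* (x ℤ.- y) ≡ c ℤ.* x ℤ.- c ℤ.* y
    *-distribˡ-minus = solve-∀

  ≋-*ʳ : ∀ c {x y} → x ≋ y [mod q ] → x ℤ.* c ≋ y ℤ.* c [mod q ]
  ≋-*ʳ c {x} {y} x≋y = subst₂ (_≋_[mod q ]) (ℤ.*-comm c x) (ℤ.*-comm c y) (≋-*ˡ c x≋y)

  ≋-*-swap : ∀ c x {a b} → c ℤ.* a ≋ b [mod q ] → c ℤ.* x ℤ.* a ≋ x ℤ.* b [mod q ]
  ≋-*-swap c x {a} {b} ca≋b = subst (_≋ x ℤ.* b [mod q ]) (x*[c*a]≡c*x*a x c a) (≋-*ˡ x ca≋b)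
    where
    x*[c*a]≡c*x*a : ∀ x c a → x ℤ.* (c ℤ.* a) ≡ c ℤ.* x ℤ.* a
    x*[c*a]≡c*x*a = solve-∀

  y+kq≋y : ∀ y k → y ℤ.+ k ℤ.* + q ≋ y [mod q ]
  y+kq≋y y k = ∣⇒≋ (divides k (m+n-m≡n y (k ℤ.* + q)))
    where
    m+n-m≡n : ∀ m n → m ℤ.+ n ℤ.- m ≡ n
    m+n-m≡n = solve-∀

  x≋y⇒x≡y+kq : ∀ {x y} → x ≋ y [mod q ] → ∃ λ k → x ≡ y ℤ.+ k ℤ.* + q
  x≋y⇒x≡y+kq {x} {y} x≋y with ≋⇒∣ x≋y
  ... | divides k x-y≡kq = k , trans (m≡n+[m-n] x y) (cong (λ d → y ℤ.+ d) x-y≡kq)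
    where
    m≡n+[m-n] : ∀ m n → m ≡ n ℤ.+ (m ℤ.- n)
    m≡n+[m-n] = solve-∀

r⊓[q∸r]≤∣r+jq∣ : ∀ {q r} j → r ℕ.< q → r ℕ.⊓ (q ℕ.∸ r) ℕ.≤ ∣ + r ℤ.+ j ℤ.* + q ∣
r⊓[q∸r]≤∣r+jq∣ {q} {r} (+ n) _ rewrite sym (ℤ.pos-* n q) =
  ℕ.≤-trans (ℕ.m⊓n≤m r (q ℕ.∸ r)) (ℕ.m≤m+n r (n ℕ.* q))
r⊓[q∸r]≤∣r+jq∣ {q} {r} -[1+ n ] r<q = begin
  r ℕ.⊓ (q ℕ.∸ r)                ≤⟨ ℕ.m⊓n≤n r (q ℕ.∸ r) ⟩
  q ℕ.∸ r                        ≤⟨ ℕ.∸-monoˡ-≤ r (ℕ.m≤m+n q (n ℕ.* q)) ⟩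
  suc n ℕ.* q ℕ.∸ r              ≡⟨ ℤ.∣⊖∣-≤ r≤[1+n]q ⟨
  ∣ r ℤ.⊖ suc n ℕ.* q ∣          ≡⟨ cong ∣_∣ (ℤ.m-n≡m⊖n r (suc n ℕ.* q)) ⟨
  ∣ + r ℤ.- + (suc n ℕ.* q) ∣    ≡⟨ cong (λ d → ∣ + r ℤ.+ d ∣) -[1+n]*q ⟩
  ∣ + r ℤ.+ -[1+ n ] ℤ.* + q ∣   ∎
  where
  open ℕ.≤-Reasoning
  r≤[1+n]q : r ℕ.≤ suc n ℕ.* q
  r≤[1+n]q = ℕ.≤-trans (ℕ.<⇒≤ r<q) (ℕ.m≤m+n q (n ℕ.* q))
  -[1+n]*q : ℤ.- + (suc n ℕ.* q) ≡ -[1+ n ] ℤ.* + q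
  -[1+n]*q = trans (cong ℤ.-_ (ℤ.pos-* (suc n) q)) (ℤ.neg-distribˡ-* (+ suc n) (+ q))

module _ {q : ℕ} .{{_ : NonZero q}} where

  ∣-∣[q]≤∣-∣ : ∀ {x y} → x ≋ y [mod q ] → ∣ x ∣[ q ] ℕ.≤ ∣ y ∣
  ∣-∣[q]≤∣-∣ {x} {y} x≋y with x≋y⇒x≡y+kq (≋-sym x≋y)
  ... | k , y≡x+kq = subst (λ z → ∣ x ∣[ q ] ℕ.≤ ∣ z ∣) (sym (trans y≡x+kq x+kq≡r+jq))
    (r⊓[q∸r]≤∣r+jq∣ (x /ℕ q ℤ.+ k) (n%ℕd<d x q))
    where
    regroup : ∀ r m k q → r ℤ.+ m ℤ.* q ℤ.+ k ℤ.* q ≡ r ℤ.+ (m ℤ.+ k) ℤ.* q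
    regroup = solve-∀
    x+kq≡r+jq : x ℤ.+ k ℤ.* + q ≡ + (x %ℕ q) ℤ.+ (x /ℕ q ℤ.+ k) ℤ.* + q
    x+kq≡r+jq = trans (cong (λ z → z ℤ.+ k ℤ.* + q) (a≡a%ℕn+[a/ℕn]*n x q))
      (regroup (+ (x %ℕ q)) (x /ℕ q) k (+ q))

  ∣-∣[q]-attained : ∀ x → ∃ λ y → x ≋ y [mod q ] × ∣ y ∣ ≡ ∣ x ∣[ q ]
  ∣-∣[q]-attained x with x %ℕ q ℕ.≤? q ℕ.∸ x %ℕ q
  ... | yes r≤q∸r = + (x %ℕ q) , x≋r , sym (ℕ.m≤n⇒m⊓n≡m r≤q∸r)
    where
    x≋r : x ≋ + (x %ℕ q) [mod q ]
    x≋r = subst (_≋ + (x %ℕ q) [mod q ]) (sym (a≡a%ℕn+[a/ℕn]*n x q)) (y+kq≋y _ (x /ℕ q))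
  ... | no r≰q∸r = + r ℤ.- + q , x≋r-q , ∣r-q∣≡r⊓[q∸r]
    where
    r : ℕ
    r = x %ℕ q
    regroup : ∀ r m q → r ℤ.+ m ℤ.* q ≡ (r ℤ.- q) ℤ.+ (m ℤ.+ + 1) ℤ.* q
    regroup = solve-∀
    x≋r-q : x ≋ + r ℤ.- + q [mod q ]
    x≋r-q = subst (_≋ + r ℤ.- + q [mod q ])
      (sym (trans (a≡a%ℕn+[a/ℕn]*n x q) (regroup (+ r) (x /ℕ q) (+ q)))) (y+kq≋y _ (x /ℕ q ℤ.+ + 1))
    ∣r-q∣≡r⊓[q∸r] : ∣ + r ℤ.- + q ∣ ≡ r ℕ.⊓ (q ℕ.∸ r)
    ∣r-q∣≡r⊓[q∸r] = trans (cong ∣_∣ (ℤ.[+m]-[+n]≡m⊖n r q))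
      (trans (ℤ.∣⊖∣-< (n%ℕd<d x q)) (sym (ℕ.m≥n⇒m⊓n≡n (ℕ.≰⇒≥ r≰q∸r))))

  ∣-∣[q]-cong : ∀ {x y} → x ≋ y [mod q ] → ∣ x ∣[ q ] ≡ ∣ y ∣[ q ]
  ∣-∣[q]-cong x≋y = ℕ.≤-antisym (≤-of x≋y) (≤-of (≋-sym x≋y))
    where
    ≤-of : ∀ {x y} → x ≋ y [mod q ] → ∣ x ∣[ q ] ℕ.≤ ∣ y ∣[ q ]
    ≤-of {y = y} x≋y with ∣-∣[q]-attained y
    ... | y′ , y≋y′ , ∣y′∣≡ = subst (_ ℕ.≤_) ∣y′∣≡ (∣-∣[q]≤∣-∣ (≋-trans x≋y y≋y′))

  ∣-∣[q]-*-≤ : ∀ x y → ∣ x ℤ.* y ∣[ q ] ℕ.≤ ∣ x ∣[ q ] ℕ.* ∣ y ∣[ q ]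
  ∣-∣[q]-*-≤ x y with ∣-∣[q]-attained x | ∣-∣[q]-attained y
  ... | x′ , x≋x′ , ∣x′∣≡ | y′ , y≋y′ , ∣y′∣≡ = begin
    ∣ x ℤ.* y ∣[ q ]           ≤⟨ ∣-∣[q]≤∣-∣ x*y≋x′*y′ ⟩
    ∣ x′ ℤ.* y′ ∣              ≡⟨ ℤ.abs-* x′ y′ ⟩
    ∣ x′ ∣ ℕ.* ∣ y′ ∣          ≡⟨ cong₂ ℕ._*_ ∣x′∣≡ ∣y′∣≡ ⟩
    ∣ x ∣[ q ] ℕ.* ∣ y ∣[ q ]  ∎
    where
    open ℕ.≤-Reasoning
    x*y≋x′*y′ : x ℤ.* y ≋ x′ ℤ.* y′ [mod q ]
    x*y≋x′*y′ = ≋-trans (≋-*ˡ x y≋y′) (≋-*ʳ y′ x≋x′)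

toℚᵘ-ℕtoℚ : ∀ n → ℚ.toℚᵘ (ℕtoℚ n) ℚᵘ.≃ ℚᵘ.mkℚᵘ (+ n) 0
toℚᵘ-ℕtoℚ n = ℚ.toℚᵘ-fromℚᵘ (ℚᵘ.mkℚᵘ (+ n) 0)

ℕtoℚ-+ : ∀ m n → ℕtoℚ (m ℕ.+ n) ≡ ℕtoℚ m + ℕtoℚ n
ℕtoℚ-+ m n = ℚ.toℚᵘ-injective (begin
  ℚ.toℚᵘ (ℕtoℚ (m ℕ.+ n))                   ≈⟨ toℚᵘ-ℕtoℚ (m ℕ.+ n) ⟩
  ℚᵘ.mkℚᵘ (+ (m ℕ.+ n)) 0                   ≈⟨ ℚᵘ.*≡* [m+n]*1≡[m*1+n*1]*1 ⟩
  ℚᵘ.mkℚᵘ (+ m) 0 ℚᵘ.+ ℚᵘ.mkℚᵘ (+ n) 0       ≈⟨ ℚᵘ.+-cong (toℚᵘ-ℕtoℚ m) (toℚᵘ-ℕtoℚ n) ⟨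
  ℚ.toℚᵘ (ℕtoℚ m) ℚᵘ.+ ℚ.toℚᵘ (ℕtoℚ n)      ≈⟨ ℚ.toℚᵘ-homo-+ (ℕtoℚ m) (ℕtoℚ n) ⟨
  ℚ.toℚᵘ (ℕtoℚ m + ℕtoℚ n)                  ∎)
  where
  open ℚᵘ.≃-Reasoning
  *1-distrib : ∀ x y → (x ℤ.+ y) ℤ.* + 1 ≡ (x ℤ.* + 1 ℤ.+ y ℤ.* + 1) ℤ.* + 1
  *1-distrib = solve-∀
  [m+n]*1≡[m*1+n*1]*1 : + (m ℕ.+ n) ℤ.* + 1 ≡ (+ m ℤ.* + 1 ℤ.+ + n ℤ.* + 1) ℤ.* + 1
  [m+n]*1≡[m*1+n*1]*1 = trans (cong (ℤ._* + 1) (ℤ.pos-+ m n)) (*1-distrib (+ m) (+ n))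

ℕtoℚ-* : ∀ m n → ℕtoℚ (m ℕ.* n) ≡ ℕtoℚ m * ℕtoℚ n
ℕtoℚ-* m n = ℚ.toℚᵘ-injective (begin
  ℚ.toℚᵘ (ℕtoℚ (m ℕ.* n))                   ≈⟨ toℚᵘ-ℕtoℚ (m ℕ.* n) ⟩
  ℚᵘ.mkℚᵘ (+ (m ℕ.* n)) 0                   ≈⟨ ℚᵘ.*≡* (cong (ℤ._* + 1) (ℤ.pos-* m n)) ⟩
  ℚᵘ.mkℚᵘ (+ m) 0 ℚᵘ.* ℚᵘ.mkℚᵘ (+ n) 0       ≈⟨ ℚᵘ.*-cong (toℚᵘ-ℕtoℚ m) (toℚᵘ-ℕtoℚ n) ⟨
  ℚ.toℚᵘ (ℕtoℚ m) ℚᵘ.* ℚ.toℚᵘ (ℕtoℚ n)      ≈⟨ ℚ.toℚᵘ-homo-* (ℕtoℚ m) (ℕtoℚ n) ⟨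
  ℚ.toℚᵘ (ℕtoℚ m * ℕtoℚ n)                  ∎)
  where open ℚᵘ.≃-Reasoning

ℕtoℚ-mono-≤ : ∀ {m n} → m ℕ.≤ n → ℕtoℚ m ≤ ℕtoℚ n
ℕtoℚ-mono-≤ {m} {n} m≤n = ℚ.toℚᵘ-cancel-≤ (begin
  ℚ.toℚᵘ (ℕtoℚ m)   ≃⟨ toℚᵘ-ℕtoℚ m ⟩
  ℚᵘ.mkℚᵘ (+ m) 0   ≤⟨ ℚᵘ.*≤* (ℤ.*-monoʳ-≤-nonNeg (+ 1) (ℤ.+≤+ m≤n)) ⟩
  ℚᵘ.mkℚᵘ (+ n) 0   ≃⟨ toℚᵘ-ℕtoℚ n ⟨
  ℚ.toℚᵘ (ℕtoℚ n)   ∎)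
  where open ℚᵘ.≤-Reasoning

ℕtoℚ-nonNeg : ∀ n → 0ℚ ≤ ℕtoℚ n
ℕtoℚ-nonNeg n = ℚ.nonNegative⁻¹ (ℕtoℚ n) {{ℚ.normalize-nonNeg n 1}}

ℕtoℚ-pos : ∀ n .{{_ : NonZero n}} → Positive (ℕtoℚ n)
ℕtoℚ-pos (suc n) = ℚ.normalize-pos (suc n) 1

/-*-cancel : ∀ m n .{{_ : NonZero n}} → (+ m ℚ./ n) * ℕtoℚ n ≡ ℕtoℚ m
/-*-cancel m n@(suc n-1) = ℚ.toℚᵘ-injective (begin
  ℚ.toℚᵘ ((+ m ℚ./ n) * ℕtoℚ n)             ≈⟨ ℚ.toℚᵘ-homo-* (+ m ℚ./ n) (ℕtoℚ n) ⟩
  ℚ.toℚᵘ (+ m ℚ./ n) ℚᵘ.* ℚ.toℚᵘ (ℕtoℚ n)   ≈⟨ ℚᵘ.*-cong (ℚ.toℚᵘ-fromℚᵘ (ℚᵘ.mkℚᵘ (+ m) n-1)) (toℚᵘ-ℕtoℚ n) ⟩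
  ℚᵘ.mkℚᵘ (+ m) n-1 ℚᵘ.* ℚᵘ.mkℚᵘ (+ n) 0    ≈⟨ ℚᵘ.*≡* m*n*1≡m*[n*1] ⟩
  ℚᵘ.mkℚᵘ (+ m) 0                           ≈⟨ toℚᵘ-ℕtoℚ m ⟨
  ℚ.toℚᵘ (ℕtoℚ m)                           ∎)
  where
  open ℚᵘ.≃-Reasoning
  m*n*1≡m*[n*1] : + m ℤ.* + n ℤ.* + 1 ≡ + m ℤ.* + (n ℕ.* 1)
  m*n*1≡m*[n*1] = trans (ℤ.*-identityʳ (+ m ℤ.* + n)) (cong (λ d → + m ℤ.* + d) (sym (ℕ.*-identityʳ n)))

0≤*0≤⇒0≤* : ∀ {a b} → 0ℚ ≤ a → 0ℚ ≤ b → 0ℚ ≤ a * b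
0≤*0≤⇒0≤* {a} {b} 0≤a 0≤b =
  ℚ.nonNegative⁻¹ (a * b) {{ℚ.nonNeg*nonNeg⇒nonNeg a {{ℚ.nonNegative 0≤a}} b {{ℚ.nonNegative 0≤b}}}}

*-mono-≤-nonNeg : ∀ {a b c d} → 0ℚ ≤ b → 0ℚ ≤ c → a ≤ b → c ≤ d → a * c ≤ b * d
*-mono-≤-nonNeg {a} {b} {c} {d} 0≤b 0≤c a≤b c≤d = ℚ.≤-trans
  (ℚ.*-monoʳ-≤-nonNeg c {{ℚ.nonNegative 0≤c}} a≤b) (ℚ.*-monoˡ-≤-nonNeg b {{ℚ.nonNegative 0≤b}} c≤d)

a*b≤c⇒b≤a⁻¹*c : ∀ a .{{_ : Positive a}} {b c} → a * b ≤ c → b ≤ recip a * c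
a*b≤c⇒b≤a⁻¹*c a {b} {c} ab≤c = begin
  b                   ≡⟨ ℚ.*-identityˡ b ⟨
  1ℚ * b              ≡⟨ cong (_* b) (ℚ.*-inverseˡ a {{ℚ.pos⇒nonZero a}}) ⟨
  recip a * a * b     ≡⟨ ℚ.*-assoc (recip a) a b ⟩
  recip a * (a * b)   ≤⟨ ℚ.*-monoˡ-≤-nonNeg (recip a) {{a⁻¹≥0}} ab≤c ⟩
  recip a * c         ∎
  where
  open ℚ.≤-Reasoning
  a⁻¹≥0 : ℚ.NonNegative (recip a)
  a⁻¹≥0 = ℚ.pos⇒nonNeg (recip a) {{ℚ.1/pos⇒pos a}}

x≤1⇒x*ρ≤ρ : ∀ {x ρ} → 0ℚ ≤ ρ → x ≤ 1ℚ → x * ρ ≤ ρ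
x≤1⇒x*ρ≤ρ {x} {ρ} 0≤ρ x≤1 =
  ℚ.≤-trans (ℚ.*-monoʳ-≤-nonNeg ρ {{ℚ.nonNegative 0≤ρ}} x≤1) (ℚ.≤-reflexive (ℚ.*-identityˡ ρ))

a⁻¹*ρ≤ρ⊎a*ρ≤ρ : ∀ a .{{_ : Positive a}} {ρ} → 0ℚ ≤ ρ → recip a * ρ ≤ ρ ⊎ a * ρ ≤ ρ
a⁻¹*ρ≤ρ⊎a*ρ≤ρ a 0≤ρ with ℚ.≤-total a 1ℚ
... | inj₁ a≤1 = inj₂ (x≤1⇒x*ρ≤ρ 0≤ρ a≤1)
... | inj₂ 1≤a = inj₁ (x≤1⇒x*ρ≤ρ 0≤ρ (ℚ.*-cancelˡ-≤-pos a (begin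
  a * recip a  ≡⟨ ℚ.*-inverseʳ a {{ℚ.pos⇒nonZero a}} ⟩
  1ℚ           ≤⟨ 1≤a ⟩
  a            ≡⟨ ℚ.*-identityʳ a ⟨
  a * 1ℚ       ∎)))
  where open ℚ.≤-Reasoning

-- C dominates the three quantities the argument needs: t + t (so that
-- t ≤ ρ⁻¹/2 in hypothesis 3), D (K + 1) (so that vectors bounded by (K + 1) l
-- are in the range of hypothesis 3) and K (the final bound).
module Constants (D : ℚ) .{{_ : Positive D}} where

  t K C : ℚ
  t = 1ℚ ⊔ D ⊔ D * D
  K = D * t
  C = t + t ⊔ D * (K + 1ℚ) ⊔ K

  1≤t : 1ℚ ≤ t
  1≤t = ℚ.p≤q⇒p≤q⊔r (D * D) (ℚ.p≤p⊔q 1ℚ D)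

  D≤t : D ≤ t
  D≤t = ℚ.p≤q⇒p≤q⊔r (D * D) (ℚ.p≤q⊔p 1ℚ D)

  D*D≤t : D * D ≤ t
  D*D≤t = ℚ.p≤q⊔p (1ℚ ⊔ D) (D * D)

  0≤K : 0ℚ ≤ K
  0≤K = 0≤*0≤⇒0≤* (ℚ.<⇒≤ (ℚ.positive⁻¹ D)) (ℚ.≤-trans (ℚ.<⇒≤ (ℚ.positive⁻¹ 1ℚ)) 1≤t)

  t+t≤C : t + t ≤ C
  t+t≤C = ℚ.p≤q⇒p≤q⊔r K (ℚ.p≤p⊔q (t + t) (D * (K + 1ℚ)))

  D*[K+1]≤C : D * (K + 1ℚ) ≤ C
  D*[K+1]≤C = ℚ.p≤q⇒p≤q⊔r K (ℚ.p≤q⊔p (t + t) (D * (K + 1ℚ)))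

  K≤C : K ≤ C
  K≤C = ℚ.p≤q⊔p (t + t ⊔ D * (K + 1ℚ)) K

  C-pos : Positive C
  C-pos = ℚ.positive (ℚ.<-≤-trans (ℚ.positive⁻¹ (1ℚ + 1ℚ)) (ℚ.≤-trans (ℚ.+-mono-≤ 1≤t 1≤t) t+t≤C))

  module _ (ρ : ℚ) .{{_ : Positive ρ}} (ρC<1 : ρ * C < 1ℚ) where

    private
      ρ*≤1 : ∀ {x} → x ≤ C → ρ * x ≤ 1ℚ
      ρ*≤1 x≤C = ℚ.≤-trans (ℚ.*-monoˡ-≤-nonNeg ρ {{ℚ.pos⇒nonNeg ρ}} x≤C) (ℚ.<⇒≤ ρC<1)

    D*ρ≤t*ρ : D * ρ ≤ t * ρ
    D*ρ≤t*ρ = ℚ.*-monoʳ-≤-nonNeg ρ {{ℚ.pos⇒nonNeg ρ}} D≤t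

    D*[D*ρ]≤t*ρ : D * (D * ρ) ≤ t * ρ
    D*[D*ρ]≤t*ρ = ℚ.≤-trans (ℚ.≤-reflexive (sym (ℚ.*-assoc D D ρ)))
      (ℚ.*-monoʳ-≤-nonNeg ρ {{ℚ.pos⇒nonNeg ρ}} D*D≤t)

    t≤ρ⁻¹*½ : t ≤ recip ρ * ½
    t≤ρ⁻¹*½ = begin
      t                 ≡⟨ solve 1 (λ t → t := (t :+ t) :* con ½) refl t ⟩
      (t + t) * ½       ≤⟨ ℚ.*-monoʳ-≤-nonNeg ½ (a*b≤c⇒b≤a⁻¹*c ρ (ρ*≤1 t+t≤C)) ⟩
      recip ρ * 1ℚ * ½  ≡⟨ cong (_* ½) (ℚ.*-identityʳ (recip ρ)) ⟩
      recip ρ * ½       ∎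
      where open ℚ.≤-Reasoning

    [K+1]*x≤D⁻¹*x*ρ⁻¹ : ∀ x → 0ℚ ≤ x → (K + 1ℚ) * x ≤ recip D * x * recip ρ
    [K+1]*x≤D⁻¹*x*ρ⁻¹ x 0≤x = begin
      (K + 1ℚ) * x                  ≤⟨ ℚ.*-monoʳ-≤-nonNeg x {{ℚ.nonNegative 0≤x}} K+1≤D⁻¹*ρ⁻¹ ⟩
      recip D * (recip ρ * 1ℚ) * x  ≡⟨ solve 3 (λ a b x → a :* (b :* con 1ℚ) :* x := a :* x :* b)
                                         refl (recip D) (recip ρ) x ⟩
      recip D * x * recip ρ         ∎
      where
      open ℚ.≤-Reasoning
      K+1≤D⁻¹*ρ⁻¹ : K + 1ℚ ≤ recip D * (recip ρ * 1ℚ)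
      K+1≤D⁻¹*ρ⁻¹ = a*b≤c⇒b≤a⁻¹*c D (a*b≤c⇒b≤a⁻¹*c ρ (ρ*≤1 D*[K+1]≤C))

module Ball (q : ℕ) .{{_ : NonZero q}} (A : List ℤ) where

  private
    InB-via : ∀ σ y {z b} → z ≋ y ℤ.* b [mod q ] → InB q A σ y → b ∈ A →
      ℕtoℚ ∣ z ∣[ q ] ≤ σ * ℕtoℚ q
    InB-via σ y z≋yb y∈B b∈A =
      subst (λ n → ℕtoℚ n ≤ σ * ℕtoℚ q) (sym (∣-∣[q]-cong z≋yb)) (y∈B _ b∈A)

  InB-cong : ∀ σ {x y} → x ≋ y [mod q ] → InB q A σ x → InB q A σ y
  InB-cong σ {x} x≋y x∈B a a∈A = InB-via σ x (≋-*ʳ a (≋-sym x≋y)) x∈B a∈A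

  InB-mono : ∀ x {σ τ} → σ ≤ τ → InB q A σ x → InB q A τ x
  InB-mono x σ≤τ x∈B a a∈A =
    ℚ.≤-trans (x∈B a a∈A) (ℚ.*-monoʳ-≤-nonNeg (ℕtoℚ q) {{ℚ.nonNegative (ℕtoℚ-nonNeg q)}} σ≤τ)

  InB-α : ∀ α σ x {D} → ℕtoℚ ∣ α ∣[ q ] ≤ D → InB q A σ x → InB q A (D * σ) (α ℤ.* x)
  InB-α α σ x {D} ∣α∣≤D x∈B a a∈A = begin
    ℕtoℚ ∣ α ℤ.* x ℤ.* a ∣[ q ]                 ≡⟨ cong (λ z → ℕtoℚ ∣ z ∣[ q ]) (ℤ.*-assoc α x a) ⟩
    ℕtoℚ ∣ α ℤ.* (x ℤ.* a) ∣[ q ]               ≤⟨ ℕtoℚ-mono-≤ (∣-∣[q]-*-≤ α (x ℤ.* a)) ⟩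
    ℕtoℚ (∣ α ∣[ q ] ℕ.* ∣ x ℤ.* a ∣[ q ])      ≡⟨ ℕtoℚ-* ∣ α ∣[ q ] ∣ x ℤ.* a ∣[ q ] ⟩
    ℕtoℚ ∣ α ∣[ q ] * ℕtoℚ ∣ x ℤ.* a ∣[ q ]     ≤⟨ *-mono-≤-nonNeg 0≤D 0≤∣xa∣ ∣α∣≤D (x∈B a a∈A) ⟩
    D * (σ * ℕtoℚ q)                            ≡⟨ ℚ.*-assoc D σ (ℕtoℚ q) ⟨
    D * σ * ℕtoℚ q                              ∎
    where
    open ℚ.≤-Reasoning
    0≤D : 0ℚ ≤ D
    0≤D = ℚ.≤-trans (ℕtoℚ-nonNeg ∣ α ∣[ q ]) ∣α∣≤D
    0≤∣xa∣ : 0ℚ ≤ ℕtoℚ ∣ x ℤ.* a ∣[ q ]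
    0≤∣xa∣ = ℕtoℚ-nonNeg ∣ x ℤ.* a ∣[ q ]

  InB-β : ∀ α β → MulSub q A α β → ∀ σ x →
    InB q A σ x → InB q A σ (α ℤ.* x) → InB q A σ (β ℤ.* x)
  InB-β α β βA⊆A∪αA σ x x∈B αx∈B a a∈A with βA⊆A∪αA a a∈A
  ... | b , b∈A , inj₁ βa≡b  = InB-via σ x (≋-*-swap β x (≋-mod βa≡b)) x∈B b∈A
  ... | b , b∈A , inj₂ βa≡αb = InB-via σ (α ℤ.* x)
    (subst (β ℤ.* x ℤ.* a ≋_[mod q ]) (x*[α*b]≡α*x*b x α b) (≋-*-swap β x (≋-mod βa≡αb))) αx∈B b∈A
    where
    x*[α*b]≡α*x*b : ∀ x α b → x ℤ.* (α ℤ.* b) ≡ α ℤ.* x ℤ.* b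
    x*[α*b]≡α*x*b = solve-∀

δ : ∀ {r} → Fin r → ℤ → Fin r → ℤ
δ zero    c zero    = c
δ zero    c (suc j) = + 0
δ (suc i) c zero    = + 0
δ (suc i) c (suc j) = δ i c j

δ-≤ : ∀ {r} i c (l : Fin r → ℕ) → ∣ c ∣ ℕ.≤ l i → ∀ j → ∣ δ i c j ∣ ℕ.≤ l j
δ-≤ zero    c l ∣c∣≤l zero    = ∣c∣≤l
δ-≤ zero    c l ∣c∣≤l (suc j) = ℕ.z≤n
δ-≤ (suc i) c l ∣c∣≤l zero    = ℕ.z≤n
δ-≤ (suc i) c l ∣c∣≤l (suc j) = δ-≤ i c (λ k → l (suc k)) ∣c∣≤l j

lin-0 : ∀ r u → lin r (λ _ → + 0) u ≡ + 0
lin-0 zero    u = refl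
lin-0 (suc r) u = trans (ℤ.+-identityˡ _) (lin-0 r (λ j → u (suc j)))

lin-δ : ∀ r i c u → lin r (δ i c) u ≡ c ℤ.* u i
lin-δ (suc r) zero    c u =
  trans (cong (λ s → c ℤ.* u zero ℤ.+ s) (lin-0 r (λ j → u (suc j)))) (ℤ.+-identityʳ _)
lin-δ (suc r) (suc i) c u = trans (ℤ.+-identityˡ _) (lin-δ r i c (λ j → u (suc j)))

lin-scale : ∀ r c n u → lin r (λ j → c ℤ.* n j) u ≡ c ℤ.* lin r n u
lin-scale zero    c n u = sym (ℤ.*-zeroʳ c)
lin-scale (suc r) c n u = begin
  c ℤ.* n zero ℤ.* u zero ℤ.+ lin r (λ j → c ℤ.* n (suc j)) (λ j → u (suc j))
    ≡⟨ cong (λ s → c ℤ.* n zero ℤ.* u zero ℤ.+ s) (lin-scale r c (λ j → n (suc j)) (λ j → u (suc j))) ⟩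
  c ℤ.* n zero ℤ.* u zero ℤ.+ c ℤ.* lin r (λ j → n (suc j)) (λ j → u (suc j))
    ≡⟨ factor c (n zero) (u zero) _ ⟩
  c ℤ.* lin (suc r) n u ∎
  where
  open ≡-Reasoning
  factor : ∀ c a b s → c ℤ.* a ℤ.* b ℤ.+ c ℤ.* s ≡ c ℤ.* (a ℤ.* b ℤ.+ s)
  factor = solve-∀

multiples-bounded : ∀ {I : Set} (a l : I → ℕ) {k : ℚ} {L : ℕ} → 0ℚ ≤ k → (∀ i → a i ℕ.≤ l i) →
  (∀ m → suc m ℕ.≤ L →
    (∀ i → ℕtoℚ (suc m ℕ.* a i) ≤ (k + 1ℚ) * ℕtoℚ (l i)) →
    (∀ i → ℕtoℚ (suc m ℕ.* a i) ≤ k * ℕtoℚ (l i))) →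
  ∀ m → m ℕ.≤ L → ∀ i → ℕtoℚ (m ℕ.* a i) ≤ k * ℕtoℚ (l i)
multiples-bounded a l 0≤k a≤l sharpen zero _ i = 0≤*0≤⇒0≤* 0≤k (ℕtoℚ-nonNeg (l i))
multiples-bounded a l {k} 0≤k a≤l sharpen (suc m) 1+m≤L = sharpen m 1+m≤L λ i → begin
  ℕtoℚ (suc m ℕ.* a i)             ≡⟨ ℕtoℚ-+ (a i) (m ℕ.* a i) ⟩
  ℕtoℚ (a i) + ℕtoℚ (m ℕ.* a i)    ≤⟨ ℚ.+-mono-≤ (ℕtoℚ-mono-≤ (a≤l i))
                                        (multiples-bounded a l 0≤k a≤l sharpen m (ℕ.<⇒≤ 1+m≤L) i) ⟩
  ℕtoℚ (l i) + k * ℕtoℚ (l i)      ≡⟨ solve 2 (λ x k → x :+ k :* x := (k :+ con 1ℚ) :* x)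
                                          refl (ℕtoℚ (l i)) k ⟩
  (k + 1ℚ) * ℕtoℚ (l i)            ∎
  where open ℚ.≤-Reasoning

b*a≤k*c⇒a≤k*[c/b] : ∀ k a b c .{{_ : NonZero b}} →
  ℕtoℚ (b ℕ.* a) ≤ k * ℕtoℚ c → ℕtoℚ a ≤ k * (+ c ℚ./ b)
b*a≤k*c⇒a≤k*[c/b] k a b c ba≤kc = ℚ.*-cancelʳ-≤-pos (ℕtoℚ b) {{ℕtoℚ-pos b}} (begin
  ℕtoℚ a * ℕtoℚ b            ≡⟨ ℚ.*-comm (ℕtoℚ a) (ℕtoℚ b) ⟩
  ℕtoℚ b * ℕtoℚ a            ≡⟨ ℕtoℚ-* b a ⟨
  ℕtoℚ (b ℕ.* a)             ≤⟨ ba≤kc ⟩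
  k * ℕtoℚ c                 ≡⟨ cong (k *_) (/-*-cancel c b) ⟨
  k * ((+ c ℚ./ b) * ℕtoℚ b) ≡⟨ ℚ.*-assoc k (+ c ℚ./ b) (ℕtoℚ b) ⟨
  k * (+ c ℚ./ b) * ℕtoℚ b   ∎)
  where open ℚ.≤-Reasoning

module _ (D : ℚ) .{{_ : Positive D}} where

  open Constants D

  module Construction
    (q : ℕ) .{{_ : NonZero q}} (A : List ℤ) (α β : ℤ)
    (βA⊆A∪αA : MulSub q A α β) (∣α∣≤D : ℕtoℚ ∣ α ∣[ q ] ≤ D)
    (ρ : ℚ) .{{_ : Positive ρ}} (ρC<1 : ρ * C < 1ℚ)
    (r : ℕ) (u : Fin r → ℤ) (l : Fin r → ℕ) (lpos : ∀ i → NonZero (l i))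
    (u∈B : ∀ i → InB q A (recip D * ρ) (u i))
    (B⊆span : ∀ x → InB q A ρ x →
      ∃ λ (n : Fin r → ℤ) → (∀ i → ∣ n i ∣ ℕ.≤ l i) × (x ≡ lin r n u [mod q ]))
    (span⊆B : ∀ (n : Fin r → ℤ) → (∀ i → ∣ n i ∣ ℕ.≤ l i) → InB q A (D * ρ) (lin r n u))
    (span-rigid : ∀ (n : Fin r → ℤ) → (∀ i → ℕtoℚ ∣ n i ∣ ≤ recip D * ℕtoℚ (l i) * recip ρ) →
      ∀ (τ : ℚ) → 1ℚ ≤ τ → τ ≤ recip ρ * ½ → InB q A (τ * ρ) (lin r n u) →
      ∀ i → ℕtoℚ ∣ n i ∣ ≤ D * τ * ℕtoℚ (l i))
    where

    open Ball q A

    m*u∈B : ∀ i m → m ℕ.≤ l i → InB q A (D * ρ) (+ m ℤ.* u i)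
    m*u∈B i m m≤l = subst (InB q A (D * ρ)) (lin-δ r i (+ m) u) (span⊆B (δ i (+ m)) (δ-≤ i (+ m) l m≤l))

    βu∈B : ∀ i → InB q A ρ (β ℤ.* u i)
    βu∈B i = InB-β α β βA⊆A∪αA ρ (u i) u∈B[ρ] αu∈B[ρ]
      where
      u∈B[D*ρ] : InB q A (D * ρ) (u i)
      u∈B[D*ρ] = subst (InB q A (D * ρ)) (ℤ.*-identityˡ (u i))
        (m*u∈B i 1 (ℕ.>-nonZero⁻¹ (l i) {{lpos i}}))
      u∈B[ρ] : InB q A ρ (u i)
      u∈B[ρ] with a⁻¹*ρ≤ρ⊎a*ρ≤ρ D (ℚ.<⇒≤ (ℚ.positive⁻¹ ρ))
      ... | inj₁ D⁻¹ρ≤ρ = InB-mono (u i) D⁻¹ρ≤ρ (u∈B i)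
      ... | inj₂ Dρ≤ρ   = InB-mono (u i) Dρ≤ρ u∈B[D*ρ]
      D*[D⁻¹*ρ]≡ρ : D * (recip D * ρ) ≡ ρ
      D*[D⁻¹*ρ]≡ρ = begin
        D * (recip D * ρ)   ≡⟨ ℚ.*-assoc D (recip D) ρ ⟨
        D * recip D * ρ     ≡⟨ cong (_* ρ) (ℚ.*-inverseʳ D {{ℚ.pos⇒nonZero D}}) ⟩
        1ℚ * ρ              ≡⟨ ℚ.*-identityˡ ρ ⟩
        ρ                   ∎
        where open ≡-Reasoning
      αu∈B[ρ] : InB q A ρ (α ℤ.* u i)
      αu∈B[ρ] = subst (λ σ → InB q A σ (α ℤ.* u i)) D*[D⁻¹*ρ]≡ρ
        (InB-α α (recip D * ρ) (u i) ∣α∣≤D (u∈B i))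

    matrix : Fin r → Fin r → ℤ
    matrix i = proj₁ (B⊆span (β ℤ.* u i) (βu∈B i))

    matrix-≤ : ∀ i j → ∣ matrix i j ∣ ℕ.≤ l j
    matrix-≤ i = proj₁ (proj₂ (B⊆span (β ℤ.* u i) (βu∈B i)))

    βu≡matrix·u : ∀ i → β ℤ.* u i ≡ lin r (matrix i) u [mod q ]
    βu≡matrix·u i = proj₂ (proj₂ (B⊆span (β ℤ.* u i) (βu∈B i)))

    βm*u∈B : ∀ i m → m ℕ.≤ l i → InB q A (t * ρ) (β ℤ.* (+ m ℤ.* u i))
    βm*u∈B i m m≤l = InB-β α β βA⊆A∪αA (t * ρ) y
      (InB-mono y (D*ρ≤t*ρ ρ ρC<1) y∈B)
      (InB-mono (α ℤ.* y) (D*[D*ρ]≤t*ρ ρ ρC<1) (InB-α α (D * ρ) y ∣α∣≤D y∈B))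
      where
      y : ℤ
      y = + m ℤ.* u i
      y∈B : InB q A (D * ρ) y
      y∈B = m*u∈B i m m≤l

    βm*u≋m*matrix·u : ∀ i m → β ℤ.* (m ℤ.* u i) ≋ lin r (λ k → m ℤ.* matrix i k) u [mod q ]
    βm*u≋m*matrix·u i m = subst₂ (_≋_[mod q ])
      (sym (β*[m*u]≡m*[β*u] β m (u i))) (sym (lin-scale r m (matrix i) u))
      (≋-*ˡ m (≋-mod (βu≡matrix·u i)))
      where
      β*[m*u]≡m*[β*u] : ∀ β m u → β ℤ.* (m ℤ.* u) ≡ m ℤ.* (β ℤ.* u)
      β*[m*u]≡m*[β*u] = solve-∀

    sharpen-multiple : ∀ i m → suc m ℕ.≤ l i →
      (∀ j → ℕtoℚ (suc m ℕ.* ∣ matrix i j ∣) ≤ (K + 1ℚ) * ℕtoℚ (l j)) →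
      ∀ j → ℕtoℚ (suc m ℕ.* ∣ matrix i j ∣) ≤ K * ℕtoℚ (l j)
    sharpen-multiple i m 1+m≤l ≤[K+1]l j = subst (_≤ K * ℕtoℚ (l j)) (∣n∣≡ j)
      (span-rigid n n-in-range t 1≤t (t≤ρ⁻¹*½ ρ ρC<1)
        (InB-cong (t * ρ) (βm*u≋m*matrix·u i (+ suc m)) (βm*u∈B i (suc m) 1+m≤l)) j)
      where
      n : Fin r → ℤ
      n k = + suc m ℤ.* matrix i k
      ∣n∣≡ : ∀ k → ℕtoℚ ∣ n k ∣ ≡ ℕtoℚ (suc m ℕ.* ∣ matrix i k ∣)
      ∣n∣≡ k = cong ℕtoℚ (ℤ.abs-* (+ suc m) (matrix i k))
      n-in-range : ∀ k → ℕtoℚ ∣ n k ∣ ≤ recip D * ℕtoℚ (l k) * recip ρ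
      n-in-range k = ℚ.≤-trans (ℚ.≤-reflexive (∣n∣≡ k))
        (ℚ.≤-trans (≤[K+1]l k) ([K+1]*x≤D⁻¹*x*ρ⁻¹ ρ ρC<1 (ℕtoℚ (l k)) (ℕtoℚ-nonNeg (l k))))

    matrix-bound : ∀ i j → ℕtoℚ ∣ matrix i j ∣ ≤ C * (+ l j ℚ./ l i) {{lpos i}}
    matrix-bound i j = ℚ.≤-trans (b*a≤k*c⇒a≤k*[c/b] K ∣ matrix i j ∣ (l i) (l j) l[i]*∣matrix∣≤K*l[j])
      (ℚ.*-monoʳ-≤-nonNeg (+ l j ℚ./ l i) {{ℚ.normalize-nonNeg (l j) (l i)}} K≤C)
      where
      instance
        l[i]≢0 : NonZero (l i)
        l[i]≢0 = lpos i
      l[i]*∣matrix∣≤K*l[j] : ℕtoℚ (l i ℕ.* ∣ matrix i j ∣) ≤ K * ℕtoℚ (l j)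
      l[i]*∣matrix∣≤K*l[j] =
        multiples-bounded (λ k → ∣ matrix i k ∣) l 0≤K (matrix-≤ i) (sharpen-multiple i)
          (l i) ℕ.≤-refl j

lemma3p4 : (D : ℚ) → .{{_ : Positive D}} →
  Σ ℚ λ C → Positive C × (
    (q : ℕ) → .{{_ : NonZero q}} → (A : List ℤ) → GcdOne q A →
    (α β : ℤ) → MulSub q A α β → ℕtoℚ (∣ α ∣[ q ]) ≤ D →
    (ρ : ℚ) → .{{_ : Positive ρ}} → ρ * C < 1ℚ →
    (r : ℕ) → NonZero r →
    (u : Fin r → ℤ) → (l : Fin r → ℕ) → (lpos : ∀ i → NonZero (l i)) →
    (∀ i → InB q A (recip D * ρ) (u i)) →
    (∀ x → InB q A ρ x → ∃ λ (n : Fin r → ℤ) → (∀ i → ∣ n i ∣ ℕ.≤ l i) × (x ≡ lin r n u [mod q ])) →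
    (∀ (n : Fin r → ℤ) → (∀ i → ∣ n i ∣ ℕ.≤ l i) → InB q A (D * ρ) (lin r n u)) →
    (∀ (n : Fin r → ℤ) → (∀ i → ℕtoℚ ∣ n i ∣ ≤ recip D * ℕtoℚ (l i) * recip ρ) →
      ∀ (t : ℚ) → 1ℚ ≤ t → t ≤ recip ρ * ½ → InB q A (t * ρ) (lin r n u) →
      ∀ i → ℕtoℚ ∣ n i ∣ ≤ D * t * ℕtoℚ (l i)) →
    ∃ λ (B : Fin r → Fin r → ℤ) →
      (∀ i → β ℤ.* u i ≡ lin r (B i) u [mod q ]) ×
      (∀ i j → ℕtoℚ ∣ B i j ∣ ≤ C * (+ l j ℚ./ l i) {{lpos i}}))
lemma3p4 D = C , C-pos ,
  λ q A _ α β βA⊆A∪αA ∣α∣≤D ρ ρC<1 r _ u l lpos u∈B B⊆span span⊆B span-rigid →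
    let open Construction D q A α β βA⊆A∪αA ∣α∣≤D ρ ρC<1 r u l lpos u∈B B⊆span span⊆B span-rigid
    in matrix , βu≡matrix·u , matrix-bound
  where open Constants D
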